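{- Let $T$ be a rooted tree with $n$ vertices and one marked leaf $w$, and let $\lambda\in(0,1]$. If $n\ge \frac{1}{1-\lambda}$, then there exists a vertex $v\in V(T)$ such that, after removing the edges connecting $v$ to its children, the resulting components satisfy: the component containing the root of $T$ and $v$ has at most $\lceil\lambda n\rceil$ vertices, the component containing $w$ has at most $\lfloor(1-\lambda)n\rfloor$ vertices, and every other component has at most $n-1$ vertices.
   Formalization: The parameter λ ranges over the rationals in $(0,1]$. -}

module Defs where

open import Data.Nat using (ℕ; zero; suc)
open import Data.Fin using (Fin)
open import Data.List using (List; length)
open import Data.List.Relation.Unary.All using (All)
open import Data.List.Relation.Unary.Unique.Propositional using (Unique)
open import Data.Product using (Σ; ∃; _×_)
open import Data.Empty using (⊥)
open import Data.Integer as ℤ using (ℤ; +_)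
open import Relation.Nullary using (¬_)
open import Relation.Binary.PropositionalEquality using (_≡_; _≢_)
open import Relation.Binary.Construct.Closure.Equivalence using (EqClosure)

iter : {A : Set} → (A → A) → ℕ → A → A
iter f zero    x = x
iter f (suc k) x = f (iter f k x)

-- A rooted tree on the vertex set Fin n, given by parent pointers:
-- the root is its own "parent" (no real edge), and every vertex reaches
-- the root by following parent pointers.  The (undirected) edges of the
-- tree are {x , parent x} for x ≢ root.
record RootedTree (n : ℕ) : Set where
  field
    root     : Fin n
    parent   : Fin n → Fin n
    parent-root : parent root ≡ root
    reaches-root : ∀ x → ∃ λ k → iter parent k x ≡ root

module _ {n : ℕ} (T : RootedTree n) where
  open RootedTree T

  IsChild : Fin n → Fin n → Set
  IsChild x v = x ≢ root × parent x ≡ v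

  IsLeaf : Fin n → Set
  IsLeaf w = ∀ x → ¬ IsChild x w

  -- the edge {x , y} (oriented child x, parent y) of the tree that survives
  -- after removing all edges between v and its children
  RemEdge : Fin n → Fin n → Fin n → Set
  RemEdge v x y = x ≢ root × parent x ≡ y × parent x ≢ v

  Conn : Fin n → Fin n → Fin n → Set
  Conn v = EqClosure (RemEdge v)

-- "the set P ⊆ Fin n has at most k elements": every duplicate-free list of
-- elements of P has length ≤ k
AtMost : {n : ℕ} → (Fin n → Set) → ℤ → Set
AtMost {n} P k = (xs : List (Fin n)) → Unique xs → All P xs → + length xs ℤ.≤ k

-- Walk up from the leaf w to the root.  The subtree of w has one vertex and that of the root has n, so
-- with l = ⌈λn⌉ < n there is an edge c → v = parent c on this path where the subtree first grows beyond
-- n − l vertices.  Cut the edges from v to its children: the component of w stays inside the subtree of c,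
-- so it has at most n − l vertices; the component of the root avoids everything strictly below v, so it has
-- at most 1 + (n − |subtree of v|) ≤ l vertices; every other component misses the root.  Finally
-- n − ⌈λn⌉ ≤ ⌊(1 − λ)n⌋.
module Submission where

open import Defs
open import Algebra.Properties.Group using (⁻¹-involutive)
open import Data.Fin using (Fin; toℕ; fromℕ; fromℕ<)
open import Data.Fin.Properties using (_≟_; any?; toℕ-fromℕ; toℕ-fromℕ<)
open import Data.Integer as ℤ using (ℤ; +_; +[1+_]; -[1+_])
import Data.Integer.Properties as ℤ
open import Data.Integer.DivMod using ([n/d]*d≤n; n<s[n/ℕd]*d; div-pos-is-/ℕ)
open import Data.Integer.Tactic.RingSolver using (solve-∀)
open import Data.List using (List; []; _∷_; length; filter; allFin)
open import Data.List.Membership.Propositional using (_∈_)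
open import Data.List.Membership.Propositional.Properties using (∈-allFin; ∈-filter⁺)
open import Data.List.Properties using (filter-notAll; filter-all; length-tabulate)
open import Data.List.Relation.Unary.All as All using (All; []; _∷_)
open import Data.List.Relation.Unary.All.Properties using (all-filter)
open import Data.List.Relation.Unary.AllPairs using ([]; _∷_)
open import Data.List.Relation.Unary.Any as Any using (here; there)
open import Data.List.Relation.Unary.Unique.Propositional using (Unique)
open import Data.List.Relation.Unary.Unique.Propositional.Properties using (filter⁺; allFin⁺)
open import Data.Nat as ℕ using (ℕ; zero; suc; _∸_)
import Data.Nat.Properties as ℕ
open import Data.Nat.Coprimality using (1-coprimeTo)
import Data.Nat.Coprimality as Coprime
open import Data.Product using (Σ; ∃; _×_; _,_)
open import Data.Rational
  using (ℚ; mkℚ; ↥_; ↧_; _/_; _+_; _*_; -_; _-_; _<_; _≤_; *≤*; *<*; 0ℚ; 1ℚ; floor; ceiling; Positive; positive)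
open import Data.Rational.Properties
  using ( ↥p/↧p≡p; toℚᵘ-injective; toℚᵘ-homo-+; +-0-group; neg-antimono-≤; *-zeroʳ; positive⁻¹; pos*pos⇒pos
        ; <-≤-trans; +-monoʳ-≤; module ≤-Reasoning)
open import Data.Rational.Solver using (module +-*-Solver)
import Data.Rational.Unnormalised as ℚᵘ
import Data.Rational.Unnormalised.Properties as ℚᵘ
open import Function using (id; _∘_; _⇔_; mk⇔; Equivalence)
open import Function.Properties.Equivalence using (⇔-isEquivalence)
open import Relation.Binary.Construct.Closure.Equivalence using (gfold; symmetric)
open import Relation.Binary.Definitions using (DecidableEquality)
open import Relation.Binary.PropositionalEquality as ≡ using (_≡_; _≢_; refl; cong; subst; subst₂)
open import Relation.Nullary using (¬_; Dec; yes; no; contradiction; ¬?)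
open import Relation.Nullary.Decidable using (map′)
open import Relation.Unary using (Decidable)
open import Relation.Unary.Properties using (∁?)

module _ {A : Set} (_≟_ : DecidableEquality A) where

  length-filter-≢< : ∀ {x ys} → x ∈ ys → length (filter (¬? ∘ (x ≟_)) ys) ℕ.< length ys
  length-filter-≢< {x} {ys} x∈ys = filter-notAll (¬? ∘ (x ≟_)) ys (Any.map (λ x≡y x≢y → x≢y x≡y) x∈ys)

  Unique-⊆⇒length≤ : ∀ {xs ys : List A} → Unique xs → All (_∈ ys) xs → length xs ℕ.≤ length ys
  Unique-⊆⇒length≤ []         []                = ℕ.z≤n
  Unique-⊆⇒length≤ {x ∷ _} (x∉xs ∷ u) (x∈ys ∷ xs⊆ys) = ℕ.≤-trans
    (ℕ.s≤s (Unique-⊆⇒length≤ u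
      (All.zipWith (λ (x≢y , y∈ys) → ∈-filter⁺ (¬? ∘ (x ≟_)) y∈ys x≢y) (x∉xs , xs⊆ys))))
    (length-filter-≢< x∈ys)

length-filter+length-filter-∁ : ∀ {A : Set} {P : A → Set} (P? : Decidable P) xs →
  length (filter P? xs) ℕ.+ length (filter (∁? P?) xs) ≡ length xs
length-filter+length-filter-∁ P? []       = refl
length-filter+length-filter-∁ P? (x ∷ xs) with P? x
... | yes _ = cong suc (length-filter+length-filter-∁ P? xs)
... | no  _ = ≡.trans (ℕ.+-suc _ _) (cong suc (length-filter+length-filter-∁ P? xs))

length-allFin : ∀ n → length (allFin n) ≡ n
length-allFin n = length-tabulate id

atMost-⊆ : ∀ {n} {P : Fin n → Set} {k} (ys : List (Fin n)) →
           (∀ {x} → P x → x ∈ ys) → length ys ℕ.≤ k → AtMost P (+ k)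
atMost-⊆ ys P⊆ys ys≤k xs unique Pxs =
  ℤ.+≤+ (ℕ.≤-trans (Unique-⊆⇒length≤ _≟_ unique (All.map P⊆ys Pxs)) ys≤k)

atMost-weaken : ∀ {n} {P : Fin n → Set} {k k′} → k ℤ.≤ k′ → AtMost P k → AtMost P k′
atMost-weaken k≤k′ atMost xs unique Pxs = ℤ.≤-trans (atMost xs unique Pxs) k≤k′

crossing : ∀ {P : ℕ → Set} → (∀ j → Dec (P j)) → P 0 → ∀ K → ¬ P K → ∃ λ j → P j × ¬ P (suc j)
crossing P? P0 zero    ¬PK = contradiction P0 ¬PK
crossing P? P0 (suc K) ¬PK with P? K
... | yes PK  = K , PK , ¬PK
... | no ¬PK′ = crossing P? P0 K ¬PK′

iter-suc : ∀ {A : Set} (f : A → A) k x → iter f (suc k) x ≡ iter f k (f x)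
iter-suc f zero    x = refl
iter-suc f (suc k) x = cong f (iter-suc f k x)

-- z / 1 written in normal form, so that numerator and denominator compute.
fromℤ : ℤ → ℚ
fromℤ z = mkℚ z 0 (Coprime.sym (1-coprimeTo ℤ.∣ z ∣))

/1≡fromℤ : ∀ z → z / 1 ≡ fromℤ z
/1≡fromℤ z = ↥p/↧p≡p (fromℤ z)

fromℤ-cancel-< : ∀ {a b} → fromℤ a < fromℤ b → a ℤ.< b
fromℤ-cancel-< {a} {b} (*<* a<b) = subst₂ ℤ._<_ (ℤ.*-identityʳ a) (ℤ.*-identityʳ b) a<b

fromℤ-homo-+ : ∀ a b → fromℤ (a ℤ.+ b) ≡ fromℤ a + fromℤ b
fromℤ-homo-+ a b =
  toℚᵘ-injective (ℚᵘ.≃-sym (ℚᵘ.≃-trans (toℚᵘ-homo-+ (fromℤ a) (fromℤ b)) (ℚᵘ.*≡* (eq a b))))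
  where
  eq : ∀ a b → (a ℤ.* + 1 ℤ.+ b ℤ.* + 1) ℤ.* + 1 ≡ (a ℤ.+ b) ℤ.* (+ 1 ℤ.* + 1)
  eq = solve-∀

fromℤ-homo‿- : ∀ a → fromℤ (ℤ.- a) ≡ - fromℤ a
fromℤ-homo‿- (+ 0)    = refl
fromℤ-homo‿- +[1+ _ ] = refl
fromℤ-homo‿- -[1+ _ ] = refl

fromℤ-floor≤ : ∀ p → fromℤ (floor p) ≤ p
fromℤ-floor≤ p@record{} =
  *≤* (subst (floor p ℤ.* ↧ p ℤ.≤_) (≡.sym (ℤ.*-identityʳ (↥ p))) ([n/d]*d≤n (↥ p) (↧ p)))

floor-greatest : ∀ {z p} → fromℤ z ≤ p → z ℤ.≤ floor p
floor-greatest {z} {p@(mkℚ a d _)} (*≤* z*d≤a*1) = ℤ.≮⇒≥ λ floor<z → ℤ.<-irrefl refl (begin-strict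
  a                        <⟨ subst (λ q → a ℤ.< ℤ.suc q ℤ.* ↧ p) (≡.sym (div-pos-is-/ℕ a (suc d)))
                                    (n<s[n/ℕd]*d a (suc d)) ⟩
  ℤ.suc (floor p) ℤ.* ↧ p  ≤⟨ ℤ.*-monoʳ-≤-nonNeg (↧ p) (ℤ.i<j⇒suc[i]≤j floor<z) ⟩
  z ℤ.* ↧ p                ≤⟨ z*d≤a*1 ⟩
  a ℤ.* + 1                ≡⟨ ℤ.*-identityʳ a ⟩
  a                        ∎)
  where open ℤ.≤-Reasoning

≤-fromℤ-ceiling : ∀ p → p ≤ fromℤ (ceiling p)
≤-fromℤ-ceiling p@record{} = begin
  p                         ≡⟨ ⁻¹-involutive +-0-group p ⟨
  - - p                     ≤⟨ neg-antimono-≤ (fromℤ-floor≤ (- p)) ⟩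
  - fromℤ (floor (- p))     ≡⟨ fromℤ-homo‿- (floor (- p)) ⟨
  fromℤ (ceiling p)         ∎
  where open ≤-Reasoning

ceiling-least : ∀ {p z} → p ≤ fromℤ z → ceiling p ℤ.≤ z
ceiling-least {p@record{}} {z} p≤z = begin
  ℤ.- floor (- p)  ≤⟨ ℤ.neg-mono-≤ (floor-greatest -z≤-p) ⟩
  ℤ.- ℤ.- z        ≡⟨ ℤ.neg-involutive z ⟩
  z                ∎
  where
  open ℤ.≤-Reasoning
  -z≤-p : fromℤ (ℤ.- z) ≤ - p
  -z≤-p = subst (_≤ - p) (≡.sym (fromℤ-homo‿- z)) (neg-antimono-≤ p≤z)

fromℤ-homo-- : ∀ a b → fromℤ (a ℤ.- b) ≡ fromℤ a - fromℤ b
fromℤ-homo-- a b = ≡.trans (fromℤ-homo-+ a (ℤ.- b)) (cong (_+_ (fromℤ a)) (fromℤ-homo‿- b))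

ceiling-pos : ∀ {p} → 0ℚ < p → + 0 ℤ.< ceiling p
ceiling-pos {p} 0<p = fromℤ-cancel-< (<-≤-trans 0<p (≤-fromℤ-ceiling p))

ceiling< : ∀ z p → 1ℚ ≤ fromℤ z - p → ceiling p ℤ.< z
ceiling< z p 1≤z-p = ℤ.i≤pred[j]⇒i<j (subst (ceiling p ℤ.≤_) (ℤ.+-comm z (ℤ.- + 1)) (ceiling-least (begin
  p                        ≡⟨ solve 2 (λ z p → p := z :- (z :- p)) refl (fromℤ z) p ⟩
  fromℤ z - (fromℤ z - p)  ≤⟨ +-monoʳ-≤ (fromℤ z) (neg-antimono-≤ 1≤z-p) ⟩
  fromℤ z - 1ℚ             ≡⟨ fromℤ-homo-- z (+ 1) ⟨
  fromℤ (z ℤ.- + 1)        ∎)))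
  where open ≤-Reasoning; open +-*-Solver

sub-ceiling≤floor : ∀ z p → z ℤ.- ceiling p ℤ.≤ floor (fromℤ z - p)
sub-ceiling≤floor z p = floor-greatest (begin
  fromℤ (z ℤ.- ceiling p)          ≡⟨ fromℤ-homo-- z (ceiling p) ⟩
  fromℤ z - fromℤ (ceiling p)      ≤⟨ +-monoʳ-≤ (fromℤ z) (neg-antimono-≤ (≤-fromℤ-ceiling p)) ⟩
  fromℤ z - p                      ∎)
  where open ≤-Reasoning

ceiling-share : ∀ n p → 0ℚ < p → 1ℚ ≤ (1ℚ - p) * (+ n / 1) →
  Σ ℕ λ l → ceiling (p * (+ n / 1)) ≡ + l × 0 ℕ.< l × l ℕ.< n ×
            + (n ∸ l) ℤ.≤ floor ((1ℚ - p) * (+ n / 1))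
ceiling-share zero p _ fits with *≤* (ℤ.+≤+ ()) ← subst (1ℚ ≤_) (*-zeroʳ (1ℚ - p)) fits
ceiling-share n@(suc _) p 0<p fits rewrite /1≡fromℤ (+ n) =
  l , ≡.sym +l≡k , ℤ.drop‿+<+ (subst (+ 0 ℤ.<_) (≡.sym +l≡k) 0<k) , l<n
    , subst (λ r → + (n ∸ l) ℤ.≤ floor r) (≡.sym r≡n-q) n-l≤floor
  where
  q : ℚ
  q = p * fromℤ (+ n)
  r≡n-q : (1ℚ - p) * fromℤ (+ n) ≡ fromℤ (+ n) - q
  r≡n-q = solve 2 (λ p N → (con 1ℚ :- p) :* N := N :- p :* N) refl p (fromℤ (+ n))
    where open +-*-Solver
  instance
    p-pos : Positive p
    p-pos = positive 0<p
  0<k : + 0 ℤ.< ceiling q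
  0<k = ceiling-pos (positive⁻¹ q {{pos*pos⇒pos p (fromℤ (+ n))}})
  l : ℕ
  l = ℤ.∣ ceiling q ∣
  +l≡k : + l ≡ ceiling q
  +l≡k = ℤ.0≤i⇒+∣i∣≡i (ℤ.<⇒≤ 0<k)
  l<n : l ℕ.< n
  l<n = ℤ.drop‿+<+ (subst (ℤ._< + n) (≡.sym +l≡k) (ceiling< (+ n) q (subst (1ℚ ≤_) r≡n-q fits)))
  n-l≤floor : + (n ∸ l) ℤ.≤ floor (fromℤ (+ n) - q)
  n-l≤floor = subst (ℤ._≤ floor (fromℤ (+ n) - q)) n-k≡n-l (sub-ceiling≤floor (+ n) q)
    where
    n-k≡n-l : + n ℤ.- ceiling q ≡ + (n ∸ l)
    n-k≡n-l = begin
      + n ℤ.- ceiling q  ≡⟨ cong (λ k → + n ℤ.- k) +l≡k ⟨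
      + n ℤ.- + l        ≡⟨ ℤ.[+m]-[+n]≡m⊖n n l ⟩
      n ℤ.⊖ l            ≡⟨ ℤ.⊖-≥ (ℕ.<⇒≤ l<n) ⟩
      + (n ∸ l)          ∎
      where open ≡.≡-Reasoning

module _ {n : ℕ} (T : RootedTree n) where
  open RootedTree T

  Subtree : Fin n → Fin n → Set
  Subtree u x = ∃ λ k → iter parent k x ≡ u

  iter-root : ∀ k → iter parent k root ≡ root
  iter-root zero    = refl
  iter-root (suc k) = ≡.trans (cong parent (iter-root k)) parent-root

  iter-beyond-root : ∀ {K k x} → K ℕ.≤ k → iter parent K x ≡ root → iter parent k x ≡ root
  iter-beyond-root {K} {x = x} K≤k eq = go (ℕ.≤⇒≤′ K≤k)
    where
    go : ∀ {k} → K ℕ.≤′ k → iter parent k x ≡ root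
    go ℕ.≤′-refl = eq
    go (ℕ.≤′-step K≤′k) = ≡.trans (cong parent (go K≤′k)) parent-root

  subtree? : ∀ u → Decidable (Subtree u)
  subtree? u x with K , iterK≡root ← reaches-root x =
    map′ (λ (i , eq) → toℕ i , eq) bounded (any? (λ i → iter parent (toℕ i) x ≟ u))
    where
    bounded : Subtree u x → ∃ λ (i : Fin (suc K)) → iter parent (toℕ i) x ≡ u
    bounded (k , eq) with k ℕ.≤? K
    ... | yes k≤K = fromℕ< (ℕ.s≤s k≤K) , ≡.trans (cong (λ j → iter parent j x) (toℕ-fromℕ< (ℕ.s≤s k≤K))) eq
    ... | no  k≰K = fromℕ K , (begin
      iter parent (toℕ (fromℕ K)) x   ≡⟨ cong (λ j → iter parent j x) (toℕ-fromℕ K) ⟩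
      iter parent K x                 ≡⟨ iterK≡root ⟩
      root                            ≡⟨ iter-beyond-root (ℕ.<⇒≤ (ℕ.≰⇒> k≰K)) iterK≡root ⟨
      iter parent k x                 ≡⟨ eq ⟩
      u                               ∎)
      where open ≡.≡-Reasoning

  child-on-path : ∀ k {u x} → iter parent k x ≡ u → x ≢ u → ∃ λ c → IsChild T c u × Subtree c x
  child-on-path zero        x≡u x≢u = contradiction x≡u x≢u
  child-on-path (suc k) {u} {x} eq x≢u with iter parent k x ≟ root
  ... | no  c≢root = iter parent k x , (c≢root , eq) , k , refl
  ... | yes c≡root = child-on-path k (begin
    iter parent k x            ≡⟨ c≡root ⟩
    root                       ≡⟨ parent-root ⟨
    parent root                ≡⟨ cong parent c≡root ⟨
    parent (iter parent k x)   ≡⟨ eq ⟩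
    u                          ∎) x≢u
    where open ≡.≡-Reasoning

  Subtree-respects-RemEdge : ∀ {c v a b} → parent c ≡ v → RemEdge T v a b → Subtree c a ⇔ Subtree c b
  Subtree-respects-RemEdge {c} {a = a} pc≡v (_ , refl , pa≢v) = mk⇔ up down
    where
    up : Subtree c a → Subtree c (parent a)
    up (zero  , refl) = contradiction pc≡v pa≢v
    up (suc k , eq)   = k , ≡.trans (≡.sym (iter-suc parent k a)) eq
    down : Subtree c (parent a) → Subtree c a
    down (k , eq) = suc k , ≡.trans (iter-suc parent k a) eq

  Subtree-respects-Conn : ∀ {c v a b} → parent c ≡ v → Conn T v a b → Subtree c a ⇔ Subtree c b
  Subtree-respects-Conn pc≡v = gfold ⇔-isEquivalence (Subtree _) (Subtree-respects-RemEdge pc≡v)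

  leaf-subtree : ∀ {w x} → IsLeaf T w → Subtree w x → x ≡ w
  leaf-subtree {w} {x} leaf (k , eq) with x ≟ w
  ... | yes x≡w = x≡w
  ... | no  x≢w = let c , c-child , _ = child-on-path k eq x≢w in contradiction c-child (leaf c)

  inside outside : Fin n → List (Fin n)
  inside  u = filter (subtree? u) (allFin n)
  outside u = filter (∁? (subtree? u)) (allFin n)

  inside+outside : ∀ u → length (inside u) ℕ.+ length (outside u) ≡ n
  inside+outside u = ≡.trans (length-filter+length-filter-∁ (subtree? u) (allFin n)) (length-allFin n)

  length-inside-root : length (inside root) ≡ n
  length-inside-root = ≡.trans (cong length (filter-all (subtree? root) {allFin n} (All.tabulate λ {x} _ → reaches-root x)))
                               (length-allFin n)

  length-inside-leaf : ∀ {w} → IsLeaf T w → length (inside w) ℕ.≤ 1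
  length-inside-leaf {w} leaf = Unique-⊆⇒length≤ _≟_ {ys = w ∷ []} (filter⁺ (subtree? w) (allFin⁺ n))
    (All.map (λ w∋x → here (leaf-subtree leaf w∋x)) (all-filter (subtree? w) (allFin n)))

  root-component⊆ : ∀ {v x} → Conn T v root x → x ∈ v ∷ outside v
  root-component⊆ {v} {x} conn with x ≟ v | subtree? v x
  ... | yes x≡v | _       = here x≡v
  ... | no  _   | no  v∌x = there (∈-filter⁺ (∁? (subtree? v)) (∈-allFin x) v∌x)
  ... | no  x≢v | yes (k , eq) =
    let c , (c≢root , pc≡v) , c∋x = child-on-path k eq x≢v
        j , eq′ = Equivalence.from (Subtree-respects-Conn pc≡v conn) c∋x
    in  contradiction (≡.trans (≡.sym eq′) (iter-root j)) c≢root

  component⊆inside : ∀ {c v y x} → parent c ≡ v → Subtree c y → Conn T v y x → x ∈ inside c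
  component⊆inside {x = x} pc≡v c∋y conn =
    ∈-filter⁺ (subtree? _) (∈-allFin x) (Equivalence.to (Subtree-respects-Conn pc≡v conn) c∋y)

  nonroot-component-size : ∀ {v x} → ¬ Conn T v root x → AtMost (Conn T v x) (+ (n ∸ 1))
  nonroot-component-size {v} ¬root∼x = atMost-⊆ (filter ≢root? (allFin n)) component⊆nonroot
    (subst (λ m → length (filter ≢root? (allFin n)) ℕ.≤ m ∸ 1) (length-allFin n)
      (ℕ.<⇒≤pred (length-filter-≢< _≟_ (∈-allFin root))))
    where
    ≢root? : Decidable (root ≢_)
    ≢root? = ¬? ∘ (root ≟_)
    component⊆nonroot : ∀ {y} → Conn T v _ y → y ∈ filter ≢root? (allFin n)
    component⊆nonroot {y} conn = ∈-filter⁺ ≢root? (∈-allFin y) λ { refl → ¬root∼x (symmetric (RemEdge T v) conn) }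

  SmallSubtree : ℕ → Fin n → Set
  SmallSubtree l u = length (inside u) ℕ.+ l ℕ.≤ n

  small? : ∀ l u → Dec (SmallSubtree l u)
  small? l u = length (inside u) ℕ.+ l ℕ.≤? n

  leaf-small : ∀ {w l} → IsLeaf T w → l ℕ.< n → SmallSubtree l w
  leaf-small leaf l<n = ℕ.≤-trans (ℕ.+-monoˡ-≤ _ (length-inside-leaf leaf)) l<n

  root-not-small : ∀ {l} → 0 ℕ.< l → ¬ SmallSubtree l root
  root-not-small {suc l} _ small = ℕ.m+1+n≰m n (subst (λ s → s ℕ.+ suc l ℕ.≤ n) length-inside-root small)

  not-small⇒outside< : ∀ {l u} → ¬ SmallSubtree l u → length (outside u) ℕ.< l
  not-small⇒outside< {l} {u} ¬small = ℕ.+-cancelˡ-< (length (inside u)) _ _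
    (subst (ℕ._< length (inside u) ℕ.+ l) (≡.sym (inside+outside u)) (ℕ.≰⇒> ¬small))

  cut-above-leaf : ∀ {w l} → IsLeaf T w → 0 ℕ.< l → l ℕ.< n →
    Σ (Fin n) λ v → AtMost (Conn T v root) (+ l) × AtMost (Conn T v w) (+ (n ∸ l))
      × (∀ x → ¬ Conn T v root x → AtMost (Conn T v x) (+ (n ∸ 1)))
  cut-above-leaf {w} {l} leaf 0<l l<n
    with K , w↝root ← reaches-root w
    with j , small , ¬small ← crossing (λ j → small? l (iter parent j w))
                                       (leaf-small leaf l<n) K (root-not-small 0<l ∘ subst (SmallSubtree l) w↝root)
    = parent c
    , atMost-⊆ (parent c ∷ outside (parent c)) root-component⊆ (not-small⇒outside< ¬small)
    , atMost-⊆ (inside c) (component⊆inside refl (j , refl)) (ℕ.m+n≤o⇒m≤o∸n _ small)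
    , λ _ → nonroot-component-size
    where c = iter parent j w

lemma2 : (n : ℕ) (T : RootedTree n) (w : Fin n) → IsLeaf T w →
         (λ' : ℚ) → 0ℚ < λ' → λ' ≤ 1ℚ →
         1ℚ ≤ (1ℚ - λ') * (+ n / 1) →
         Σ (Fin n) λ v →
           AtMost (Conn T v (RootedTree.root T)) (ceiling (λ' * (+ n / 1)))
           × AtMost (Conn T v w) (floor ((1ℚ - λ') * (+ n / 1)))
           × (∀ x → ¬ Conn T v (RootedTree.root T) x → ¬ Conn T v w x →
                AtMost (Conn T v x) (+ (n ∸ 1)))
lemma2 n T w leaf λ' 0<λ' _ fits
  with l , ceiling≡l , 0<l , l<n , n-l≤floor ← ceiling-share n λ' 0<λ' fits
  with v , root-part , leaf-part , other-parts ← cut-above-leaf T leaf 0<l l<n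
  = v
  , subst (AtMost _) (≡.sym ceiling≡l) root-part
  , atMost-weaken n-l≤floor leaf-part
  , λ x ¬root∼x _ → other-parts x ¬root∼x
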